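{- For every positive integer $n$, $h_3(n,\{(4,2),(4,3)\}) = g(n)$.
   Context: A $3$-graph is a pair $H=(V,E)$ with $E\subseteq\binom{V}{3}$. A homogeneous set is a clique (all triples inside are edges) or a coclique (no triple inside is an edge); $h(H)$ is the size of a largest homogeneous set. $H$ is $\{(4,2),(4,3)\}$-free if no $4$-vertex subset spans exactly $2$ or exactly $3$ edges; $h_3(n,\{(4,2),(4,3)\})$ is the minimum of $h(H)$ over all $n$-vertex $\{(4,2),(4,3)\}$-free $3$-graphs $H$. For a (not necessarily uniform) hypergraph $\mathcal{H}$, $\alpha_2(\mathcal{H})$ is the maximum size of a set $I\subseteq V(\mathcal{H})$ with $|I\cap e|\leq 2$ for every edge $e$; $g(\mathcal{H})=\max\big(\max_{e\in E(\mathcal{H})}|e|,\ \alpha_2(\mathcal{H})\big)$. A hypergraph is linear if any two distinct edges share at most one vertex. $g(n)$ is the minimum of $g(\mathcal{H})$ over all linear (not necessarily uniform) hypergraphs $\mathcal{H}$ on $n$ vertices. -}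

module Defs where

open import Data.Nat using (ℕ; zero; suc; _≤_)
open import Data.Bool using (Bool; true; false; _∧_)
open import Data.Bool.Properties using (T?)
open import Data.List using (List; []; _∷_; map; _++_; filter; length)
open import Data.Vec using (_∷_; [])
open import Data.Fin using (Fin)
open import Data.Fin.Subset using (Subset; ∣_∣; _⊆_; _∩_; inside; outside)
open import Data.Fin.Subset.Properties using (_⊆?_)
open import Data.Product using (Σ; _×_; ∃)
open import Data.Sum using (_⊎_)
open import Relation.Nullary using (¬_)
open import Relation.Nullary.Decidable using (⌊_⌋)
open import Relation.Binary.PropositionalEquality using (_≡_; _≢_)

allSubsets : (n : ℕ) → List (Subset n)
allSubsets zero = [] ∷ []
allSubsets (suc n) = map (outside ∷_) (allSubsets n) ++ map (inside ∷_) (allSubsets n)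

record ThreeGraph (n : ℕ) : Set where
  field
    edge    : Subset n → Bool
    uniform : ∀ e → edge e ≡ true → ∣ e ∣ ≡ 3
open ThreeGraph public

edgesIn : ∀ {n} → ThreeGraph n → Subset n → ℕ
edgesIn {n} H T = length (filter (λ e → T? (edge H e ∧ ⌊ e ⊆? T ⌋)) (allSubsets n))

Free42-43 : ∀ {n} → ThreeGraph n → Set
Free42-43 {n} H = ∀ (T : Subset n) → ∣ T ∣ ≡ 4 → (edgesIn H T ≢ 2) × (edgesIn H T ≢ 3)

IsClique : ∀ {n} → ThreeGraph n → Subset n → Set
IsClique {n} H S = ∀ (e : Subset n) → e ⊆ S → ∣ e ∣ ≡ 3 → edge H e ≡ true

IsCoclique : ∀ {n} → ThreeGraph n → Subset n → Set
IsCoclique {n} H S = ∀ (e : Subset n) → e ⊆ S → edge H e ≡ false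

Homogeneous : ∀ {n} → ThreeGraph n → Subset n → Set
Homogeneous H S = IsClique H S ⊎ IsCoclique H S

IsHomNum : ∀ {n} → ThreeGraph n → ℕ → Set
IsHomNum {n} H k =
  (Σ (Subset n) λ S → Homogeneous H S × ∣ S ∣ ≡ k) ×
  (∀ (S : Subset n) → Homogeneous H S → ∣ S ∣ ≤ k)

IsH3 : ℕ → ℕ → Set
IsH3 n m =
  (Σ (ThreeGraph n) λ H → Free42-43 H × IsHomNum H m) ×
  (∀ (H : ThreeGraph n) → Free42-43 H → ∀ k → IsHomNum H k → m ≤ k)

Hypergraph : ℕ → Set
Hypergraph n = Subset n → Bool

IsEdge : ∀ {n} → Hypergraph n → Subset n → Set
IsEdge H e = H e ≡ true

Linear : ∀ {n} → Hypergraph n → Set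
Linear {n} H = ∀ (e f : Subset n) → IsEdge H e → IsEdge H f → e ≢ f → ∣ e ∩ f ∣ ≤ 1

TwoIndep : ∀ {n} → Hypergraph n → Subset n → Set
TwoIndep {n} H I = ∀ (e : Subset n) → IsEdge H e → ∣ I ∩ e ∣ ≤ 2

-- g(H) ≡ m, i.e. m = max(max edge size, α₂(H))  (max over no edges taken as 0,
-- harmless since α₂ ≥ 0 is always attained by the empty set)
IsGNum : ∀ {n} → Hypergraph n → ℕ → Set
IsGNum {n} H m =
  (∀ (e : Subset n) → IsEdge H e → ∣ e ∣ ≤ m) ×
  (∀ (I : Subset n) → TwoIndep H I → ∣ I ∣ ≤ m) ×
  ((Σ (Subset n) λ e → IsEdge H e × ∣ e ∣ ≡ m) ⊎
   (Σ (Subset n) λ I → TwoIndep H I × ∣ I ∣ ≡ m))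

IsG : ℕ → ℕ → Set
IsG n m =
  (Σ (Hypergraph n) λ H → Linear H × IsGNum H m) ×
  (∀ (H : Hypergraph n) → Linear H → ∀ k → IsGNum H k → m ≤ k)

-- A 3-graph is {(4,2),(4,3)}-free exactly when it is K4-closed: two edges inside a 4-set
-- force all four triples of that set to be edges.  For a linear hypergraph G, the triples
-- covered by an edge of G form a K4-closed 3-graph whose cliques with at least three
-- vertices lie inside a single edge of G and whose cocliques are the 2-independent sets of
-- G, so its homogeneity number is g(G).  Conversely, in a K4-closed 3-graph two cliques
-- sharing two vertices span a clique, so the maximal cliques with at least three vertices
-- form a linear hypergraph whose edges are cliques and whose 2-independent sets are
-- cocliques; its g-value is at most h.  Hence both minima equal the least k such that some
-- linear hypergraph on n vertices has g ≤ k, which exists because the hypergraphs on a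
-- finite set can be enumerated.
module Submission where

open import Defs
open import Data.Bool as Bool using (Bool; true; false; _∧_)
open import Data.Bool.Properties using (T?; T-∧; T-≡)
open import Data.Fin as Fin using (Fin; zero; suc)
open import Data.Fin.Properties using (any?)
open import Data.Fin.Subset
open import Data.Fin.Subset.Induction using (Acc; acc; ⊃-wellFounded)
open import Data.Fin.Subset.Properties
open import Data.List using (List; []; _∷_; map; _++_; filter; length)
open import Data.List.Membership.Propositional using (lose) renaming (_∈_ to _∈ₗ_)
open import Data.List.Membership.Propositional.Properties
  using (∈-filter⁺; ∈-filter⁻; ∈-map⁺; ∈-map⁻; ∈-++⁺ˡ; ∈-++⁺ʳ)
open import Data.List.Relation.Unary.All as All using ([]; _∷_)
open import Data.List.Relation.Unary.AllPairs using ([]; _∷_)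
import Data.List.Relation.Unary.Any as Any
open import Data.List.Relation.Unary.Unique.Propositional using (Unique)
import Data.List.Relation.Unary.Unique.Propositional.Properties as Unique
open import Data.Nat using (ℕ; zero; suc; _≤_; _<_; z≤n; s≤s; _≤?_)
open import Data.Nat.Induction using (<-wellFounded)
open import Data.Nat.Properties as ℕ using (≤-trans)
open import Data.Product using (Σ; ∃; ∃₂; _×_; _,_; proj₁; proj₂)
open import Data.Sum using (_⊎_; inj₁; inj₂)
open import Data.Vec using (_∷_; []; here; there)
open import Data.Vec.Properties using (≡-dec)
open import Function using (id; _∘_; case_of_)
open import Function.Bundles using (module Equivalence)
open import Level using (0ℓ)
open import Relation.Binary.Definitions using (DecidableEquality)
open import Relation.Binary.PropositionalEquality
  using (_≡_; _≢_; _≗_; refl; sym; trans; cong; subst; subst₂)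
open import Relation.Nullary using (¬_; Dec; yes; no; does; contradiction; ¬?)
open import Relation.Nullary.Decidable
  using (⌊_⌋; fromWitness; toWitness; dec-true; dec-false; decidable-stable; _×-dec_; _→-dec_)
open import Relation.Unary using (Pred; Decidable)

open Equivalence using (to; from)

private
  variable
    n : ℕ
    p q t : Subset n
    x y : Fin n

does⇒ : ∀ {A : Set} (a? : Dec A) → does a? ≡ true → A
does⇒ (yes a) _ = a
does⇒ (no _)  ()

∣p∣≡1+∣p-x∣ : x ∈ p → ∣ p ∣ ≡ suc ∣ p - x ∣
∣p∣≡1+∣p-x∣ {x = zero}  {p = inside ∷ p}  here        = cong (suc ∘ ∣_∣) (sym (p─⊥≡p p))
∣p∣≡1+∣p-x∣ {x = suc x} {p = inside ∷ p}  (there x∈p) = cong suc (∣p∣≡1+∣p-x∣ x∈p)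
∣p∣≡1+∣p-x∣ {x = suc x} {p = outside ∷ p} (there x∈p) = ∣p∣≡1+∣p-x∣ x∈p

∣p-x∣≡ : ∀ {k} → x ∈ p → ∣ p ∣ ≡ suc k → ∣ p - x ∣ ≡ k
∣p-x∣≡ x∈p ∣p∣≡1+k = ℕ.suc-injective (trans (sym (∣p∣≡1+∣p-x∣ x∈p)) ∣p∣≡1+k)

∣p∪⁅x⁆∣≡1+∣p∣ : x ∉ p → ∣ p ∪ ⁅ x ⁆ ∣ ≡ suc ∣ p ∣
∣p∪⁅x⁆∣≡1+∣p∣ {x = zero}  {p = inside ∷ p}  x∉p = contradiction here x∉p
∣p∪⁅x⁆∣≡1+∣p∣ {x = zero}  {p = outside ∷ p} x∉p = cong (suc ∘ ∣_∣) (∪-identityʳ p)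
∣p∪⁅x⁆∣≡1+∣p∣ {x = suc x} {p = inside ∷ p}  x∉p = cong suc (∣p∪⁅x⁆∣≡1+∣p∣ (x∉p ∘ there))
∣p∪⁅x⁆∣≡1+∣p∣ {x = suc x} {p = outside ∷ p} x∉p = ∣p∪⁅x⁆∣≡1+∣p∣ (x∉p ∘ there)

x∉p-x : ∀ (p : Subset n) x → x ∉ p - x
x∉p-x (_ ∷ p) zero    ()
x∉p-x (_ ∷ p) (suc x) (there x∈p-x) = x∉p-x p x x∈p-x

x∈p-y⇒x∈p : x ∈ p - y → x ∈ p
x∈p-y⇒x∈p {p = p} {y = y} = p─q⊆p p ⁅ y ⁆

x∈p-y⇒x≢y : x ∈ p - y → x ≢ y
x∈p-y⇒x≢y {x = x} {p = p} x∈p-x refl = x∉p-x p x x∈p-x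

p-x≡p-y⇒x≡y : x ∈ p → p - x ≡ p - y → x ≡ y
p-x≡p-y⇒x≡y {x = x} {p = p} {y = y} x∈p p-x≡p-y with x Fin.≟ y
... | yes x≡y = x≡y
... | no  x≢y = contradiction (subst (x ∈_) (sym p-x≡p-y) (x∈p∧x≢y⇒x∈p-y x∈p x≢y)) (x∉p-x p x)

∈∧∉⇒≢ : x ∈ p → y ∉ p → x ≢ y
∈∧∉⇒≢ x∈p y∉p refl = y∉p x∈p

x∈p∪q∧x∉q⇒x∈p : x ∈ p ∪ q → x ∉ q → x ∈ p
x∈p∪q∧x∉q⇒x∈p {p = p} {q = q} x∈p∪q x∉q with x∈p∪q⁻ p q x∈p∪q
... | inj₁ x∈p = x∈p
... | inj₂ x∈q = contradiction x∈q x∉q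

x∈p∪q∧x∉p⇒x∈q : x ∈ p ∪ q → x ∉ p → x ∈ q
x∈p∪q∧x∉p⇒x∈q {p = p} {q = q} x∈p∪q x∉p with x∈p∪q⁻ p q x∈p∪q
... | inj₁ x∈p = contradiction x∈p x∉p
... | inj₂ x∈q = x∈q

⊈⇒∃∈∉ : ¬ (q ⊆ p) → ∃ λ x → x ∈ q × x ∉ p
⊈⇒∃∈∉ {q = q} {p = p} q⊈p with any? (λ x → (x ∈? q) ×-dec ¬? (x ∈? p))
... | yes found = found
... | no  ∄x    = contradiction (λ {x} x∈q → decidable-stable (x ∈? p) λ x∉p → ∄x (x , x∈q , x∉p)) q⊈p

⊆∧∣∣≥⇒≡ : p ⊆ q → ∣ q ∣ ≤ ∣ p ∣ → p ≡ q
⊆∧∣∣≥⇒≡ {p = p} {q = q} p⊆q ∣q∣≤∣p∣ = ⊆-antisym p⊆q q⊆p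
  where
  q⊆p : q ⊆ p
  q⊆p {x} x∈q with x ∈? p
  ... | yes x∈p = x∈p
  ... | no  x∉p = contradiction ∣q∣≤∣p∣ (ℕ.<⇒≱ (p⊂q⇒∣p∣<∣q∣ (p⊆q , x , x∈q , x∉p)))

⊆∧∉⇒≡- : t ⊆ p → y ∈ p → y ∉ t → ∣ p ∣ ≤ suc ∣ t ∣ → t ≡ p - y
⊆∧∉⇒≡- {t = t} {p = p} {y = y} t⊆p y∈p y∉t ∣p∣≤1+∣t∣ =
  ⊆∧∣∣≥⇒≡ t⊆p-y (ℕ.≤-pred (≤-trans (ℕ.≤-reflexive (sym (∣p∣≡1+∣p-x∣ y∈p))) ∣p∣≤1+∣t∣))
  where
  t⊆p-y : t ⊆ p - y
  t⊆p-y x∈t = x∈p∧x≢y⇒x∈p-y (t⊆p x∈t) λ { refl → y∉t x∈t }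

∣∣<⇒∃∈∉ : ∣ p ∣ < ∣ q ∣ → ∃ λ x → x ∈ q × x ∉ p
∣∣<⇒∃∈∉ ∣p∣<∣q∣ = ⊈⇒∃∈∉ (λ q⊆p → ℕ.<⇒≱ ∣p∣<∣q∣ (p⊆q⇒∣p∣≤∣q∣ q⊆p))

0<∣p∣⇒∃∈ : ∀ {n} {p : Subset n} → 0 < ∣ p ∣ → ∃ λ x → x ∈ p
0<∣p∣⇒∃∈ {n} {p} 0<∣p∣ =
  let x , x∈p , _ = ∣∣<⇒∃∈∉ {p = ⊥} {q = p} (subst (_< ∣ p ∣) (sym (∣⊥∣≡0 n)) 0<∣p∣)
  in x , x∈p

2≤∣p∣⇒∃-distinct : 2 ≤ ∣ p ∣ → ∃₂ λ x y → x ∈ p × y ∈ p × x ≢ y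
2≤∣p∣⇒∃-distinct {p = p} 2≤∣p∣
  with x , x∈p ← 0<∣p∣⇒∃∈ (≤-trans (s≤s z≤n) 2≤∣p∣)
  with y , y∈p , y∉⁅x⁆ ← ∣∣<⇒∃∈∉ {p = ⁅ x ⁆} (subst (_< ∣ p ∣) (sym (∣⁅x⁆∣≡1 x)) 2≤∣p∣)
  = x , y , x∈p , y∈p , λ x≡y → y∉⁅x⁆ (subst (_∈ ⁅ x ⁆) x≡y (x∈⁅x⁆ x))

∃-⊆-∣∣≡ : ∀ {n} (p : Subset n) k → k ≤ ∣ p ∣ → ∃ λ t → t ⊆ p × ∣ t ∣ ≡ k
∃-⊆-∣∣≡ {n} p zero _ = ⊥ , ⊆-min p , ∣⊥∣≡0 n
∃-⊆-∣∣≡ (outside ∷ p) k k≤∣p∣ =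
  let t , t⊆p , ∣t∣≡k = ∃-⊆-∣∣≡ p k k≤∣p∣ in outside ∷ t , s⊆s t⊆p , ∣t∣≡k
∃-⊆-∣∣≡ (inside ∷ p) (suc k) (s≤s k≤∣p∣) =
  let t , t⊆p , ∣t∣≡k = ∃-⊆-∣∣≡ p k k≤∣p∣ in inside ∷ t , s⊆s t⊆p , cong suc ∣t∣≡k

_≟ₛ_ : DecidableEquality (Subset n)
_≟ₛ_ = ≡-dec Bool._≟_

⟨_,_,_⟩ : Fin n → Fin n → Fin n → Subset n
⟨ a , b , c ⟩ = (⁅ a ⁆ ∪ ⁅ b ⁆) ∪ ⁅ c ⁆

module _ {a b c : Fin n} where

  ∈⟨⟩₁ : a ∈ ⟨ a , b , c ⟩
  ∈⟨⟩₁ = p⊆p∪q ⁅ c ⁆ (p⊆p∪q ⁅ b ⁆ (x∈⁅x⁆ a))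

  ∈⟨⟩₂ : b ∈ ⟨ a , b , c ⟩
  ∈⟨⟩₂ = p⊆p∪q ⁅ c ⁆ (q⊆p∪q ⁅ a ⁆ ⁅ b ⁆ (x∈⁅x⁆ b))

  ∈⟨⟩₃ : c ∈ ⟨ a , b , c ⟩
  ∈⟨⟩₃ = q⊆p∪q (⁅ a ⁆ ∪ ⁅ b ⁆) ⁅ c ⁆ (x∈⁅x⁆ c)

  ∈⟨⟩⁻ : x ∈ ⟨ a , b , c ⟩ → x ≡ a ⊎ x ≡ b ⊎ x ≡ c
  ∈⟨⟩⁻ x∈ with x∈p∪q⁻ (⁅ a ⁆ ∪ ⁅ b ⁆) ⁅ c ⁆ x∈
  ... | inj₂ x∈c = inj₂ (inj₂ (x∈⁅y⁆⇒x≡y c x∈c))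
  ... | inj₁ x∈ab with x∈p∪q⁻ ⁅ a ⁆ ⁅ b ⁆ x∈ab
  ...   | inj₁ x∈a = inj₁ (x∈⁅y⁆⇒x≡y a x∈a)
  ...   | inj₂ x∈b = inj₂ (inj₁ (x∈⁅y⁆⇒x≡y b x∈b))

  ⟨⟩⊆ : a ∈ p → b ∈ p → c ∈ p → ⟨ a , b , c ⟩ ⊆ p
  ⟨⟩⊆ a∈p b∈p c∈p x∈ with ∈⟨⟩⁻ x∈
  ... | inj₁ refl        = a∈p
  ... | inj₂ (inj₁ refl) = b∈p
  ... | inj₂ (inj₂ refl) = c∈p

  ∣⟨⟩∣≡3 : a ≢ b → a ≢ c → b ≢ c → ∣ ⟨ a , b , c ⟩ ∣ ≡ 3
  ∣⟨⟩∣≡3 a≢b a≢c b≢c = trans (∣p∪⁅x⁆∣≡1+∣p∣ c∉ab) (cong suc ∣ab∣≡2)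
    where
    ∣ab∣≡2 : ∣ ⁅ a ⁆ ∪ ⁅ b ⁆ ∣ ≡ 2
    ∣ab∣≡2 = trans (∣p∪⁅x⁆∣≡1+∣p∣ (a≢b ∘ sym ∘ x∈⁅y⁆⇒x≡y a)) (cong suc (∣⁅x⁆∣≡1 a))
    c∉ab : c ∉ ⁅ a ⁆ ∪ ⁅ b ⁆
    c∉ab c∈ab with x∈p∪q⁻ ⁅ a ⁆ ⁅ b ⁆ c∈ab
    ... | inj₁ c∈a = a≢c (sym (x∈⁅y⁆⇒x≡y a c∈a))
    ... | inj₂ c∈b = b≢c (sym (x∈⁅y⁆⇒x≡y b c∈b))

allSubsets-complete : ∀ (p : Subset n) → p ∈ₗ allSubsets n
allSubsets-complete [] = Any.here refl
allSubsets-complete {suc n} (outside ∷ p) =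
  ∈-++⁺ˡ (∈-map⁺ (outside ∷_) (allSubsets-complete p))
allSubsets-complete {suc n} (inside ∷ p) =
  ∈-++⁺ʳ (map (outside ∷_) (allSubsets n)) (∈-map⁺ (inside ∷_) (allSubsets-complete p))

allSubsets-unique : ∀ n → Unique (allSubsets n)
allSubsets-unique zero = [] ∷ []
allSubsets-unique (suc n) =
  Unique.++⁺ (Unique.map⁺ ∷-injectiveʳ (allSubsets-unique n))
             (Unique.map⁺ ∷-injectiveʳ (allSubsets-unique n))
             disjoint
  where
  ∷-injectiveʳ : ∀ {s} {p q : Subset n} → _≡_ {A = Subset (suc n)} (s ∷ p) (s ∷ q) → p ≡ q
  ∷-injectiveʳ refl = refl
  disjoint : ∀ {p} → ¬ (p ∈ₗ map (outside ∷_) (allSubsets n) × p ∈ₗ map (inside ∷_) (allSubsets n))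
  disjoint (p∈out , p∈in) with ∈-map⁻ (outside ∷_) p∈out | ∈-map⁻ (inside ∷_) p∈in
  ... | _ , _ , refl | _ , _ , ()

module _ {A : Set} where

  remove : ∀ {y : A} xs → y ∈ₗ xs →
           ∃ λ ys → length xs ≡ suc (length ys) × (∀ {z} → z ∈ₗ xs → z ≢ y → z ∈ₗ ys)
  remove (x ∷ xs) (Any.here refl) =
    xs , refl , λ { (Any.here refl) z≢x → contradiction refl z≢x ; (Any.there z∈xs) _ → z∈xs }
  remove (x ∷ xs) (Any.there y∈xs) =
    let ys , ∣xs∣≡1+∣ys∣ , keep = remove xs y∈xs
    in x ∷ ys , cong suc ∣xs∣≡1+∣ys∣ ,
       λ { (Any.here refl) _ → Any.here refl ; (Any.there z∈xs) z≢y → Any.there (keep z∈xs z≢y) }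

  distinct⇒2≤length : ∀ {a b : A} xs → a ∈ₗ xs → b ∈ₗ xs → a ≢ b → 2 ≤ length xs
  distinct⇒2≤length (_ ∷ _ ∷ _) _ _ _ = s≤s (s≤s z≤n)
  distinct⇒2≤length (_ ∷ []) (Any.here refl) (Any.here refl) a≢b = contradiction refl a≢b

  2≤length⇒distinct : ∀ xs → Unique xs → 2 ≤ length xs →
                      ∃₂ λ (a b : A) → a ∈ₗ xs × b ∈ₗ xs × a ≢ b
  2≤length⇒distinct (a ∷ b ∷ _) ((a≢b ∷ _) ∷ _) _ =
    a , b , Any.here refl , Any.there (Any.here refl) , a≢b
  2≤length⇒distinct (_ ∷ []) _ (s≤s ())

  length≤∣∣ : ∀ (R : A → Fin n → Set) xs (S : Subset n) → Unique xs →
              (∀ {a} → a ∈ₗ xs → ∃ λ v → v ∈ S × R a v) →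
              (∀ {a b v} → a ∈ₗ xs → b ∈ₗ xs → R a v → R b v → a ≡ b) →
              length xs ≤ ∣ S ∣
  length≤∣∣ R [] S _ _ _ = z≤n
  length≤∣∣ R (a ∷ xs) S (a∉xs ∷ xs-unique) image injective with v , v∈S , Rav ← image (Any.here refl) =
    subst (suc (length xs) ≤_) (sym (∣p∣≡1+∣p-x∣ v∈S))
      (s≤s (length≤∣∣ R xs (S - v) xs-unique image′ (λ a∈ b∈ → injective (Any.there a∈) (Any.there b∈))))
    where
    image′ : ∀ {b} → b ∈ₗ xs → ∃ λ w → w ∈ S - v × R b w
    image′ {b} b∈xs =
      let w , w∈S , Rbw = image (Any.there b∈xs)
          w≢v : w ≢ v
          w≢v w≡v = All.lookup a∉xs b∈xs
                      (injective (Any.here refl) (Any.there b∈xs) Rav (subst (R b) w≡v Rbw))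
      in w , x∈p∧x≢y⇒x∈p-y w∈S w≢v , Rbw

  ∣∣≤length : ∀ (f : Fin n → A) (S : Subset n) xs →
              (∀ {v} → v ∈ S → f v ∈ₗ xs) →
              (∀ {u v} → u ∈ S → v ∈ S → f u ≡ f v → u ≡ v) →
              ∣ S ∣ ≤ length xs
  ∣∣≤length f S xs = go S xs refl
    where
    go : ∀ S xs {k} → ∣ S ∣ ≡ k → (∀ {v} → v ∈ S → f v ∈ₗ xs) →
         (∀ {u v} → u ∈ S → v ∈ S → f u ≡ f v → u ≡ v) → ∣ S ∣ ≤ length xs
    go S xs {zero} ∣S∣≡0 _ _ = subst (_≤ length xs) (sym ∣S∣≡0) z≤n
    go S xs {suc k} ∣S∣≡1+k image injective =
      let v , v∈S = 0<∣p∣⇒∃∈ (subst (0 <_) (sym ∣S∣≡1+k) (s≤s z≤n))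
          ys , ∣xs∣≡1+∣ys∣ , keep = remove xs (image v∈S)
          image′ : ∀ {u} → u ∈ S - v → f u ∈ₗ ys
          image′ u∈S-v = keep (image (x∈p-y⇒x∈p u∈S-v))
                              (x∈p-y⇒x≢y u∈S-v ∘ injective (x∈p-y⇒x∈p u∈S-v) v∈S)
      in subst₂ _≤_ (sym (∣p∣≡1+∣p-x∣ v∈S)) (sym ∣xs∣≡1+∣ys∣)
           (s≤s (go (S - v) ys (∣p-x∣≡ v∈S ∣S∣≡1+k) image′
                   (λ u∈ w∈ → injective (x∈p-y⇒x∈p u∈) (x∈p-y⇒x∈p w∈))))

allSubset? : ∀ {P : Pred (Subset n) 0ℓ} → Decidable P → Dec (∀ p → P p)
allSubset? P? with anySubset? (¬? ∘ P?)
... | yes (p , ¬Pp) = no λ ∀P → ¬Pp (∀P p)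
... | no  ∄¬P       = yes λ p → decidable-stable (P? p) λ ¬Pp → ∄¬P (p , ¬Pp)

module _ {Q : Pred ℕ 0ℓ} (Q? : Decidable Q) where

  least : ∀ {N} → Q N → ∃ λ m → Q m × (∀ j → Q j → m ≤ j)
  least {N} = go (<-wellFounded N)
    where
    go : ∀ {N} → Acc _<_ N → Q N → ∃ λ m → Q m × (∀ j → Q j → m ≤ j)
    go {N} (acc smaller) QN with ℕ.anyUpTo? Q? N
    ... | yes (j , j<N , Qj) = go (smaller j<N) Qj
    ... | no  ∄j             = N , QN , λ j Qj → ℕ.≮⇒≥ λ j<N → ∄j (j , j<N , Qj)

module _ {P : Pred (Subset n) 0ℓ} (P? : Decidable P) where

  Maximal : Pred (Subset n) 0ℓ
  Maximal p = P p × (∀ q → p ⊆ q → P q → q ⊆ p)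

  maximal? : Decidable Maximal
  maximal? p = P? p ×-dec allSubset? (λ q → (p ⊆? q) →-dec (P? q →-dec (q ⊆? p)))

  ⊆-maximal : P p → ∃ λ q → p ⊆ q × Maximal q
  ⊆-maximal {p} = grow (⊃-wellFounded p)
    where
    grow : ∀ {p} → Acc _⊃_ p → P p → ∃ λ q → p ⊆ q × Maximal q
    grow {p} (acc larger) Pp with anySubset? (λ q → (p ⊂? q) ×-dec P? q)
    ... | yes (q , p⊂q , Pq) = let r , q⊆r , Mr = grow (larger p⊂q) Pq in r , q⊆r ∘ proj₁ p⊂q , Mr
    ... | no  ∄larger        = p , id , Pp , maximal
      where
      maximal : ∀ q → p ⊆ q → P q → q ⊆ p
      maximal q p⊆q Pq with q ⊆? p
      ... | yes q⊆p = q⊆p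
      ... | no  q⊈p = contradiction (q , ((λ {x} → p⊆q {x}) , ⊈⇒∃∈∉ q⊈p) , Pq) ∄larger

sublists : ∀ {A : Set} → List A → List (List A)
sublists []       = [] ∷ []
sublists (y ∷ ys) = map (y ∷_) (sublists ys) ++ sublists ys

filter∈sublists : ∀ {A : Set} {P : Pred A 0ℓ} (P? : Decidable P) ys → filter P? ys ∈ₗ sublists ys
filter∈sublists P? [] = Any.here refl
filter∈sublists P? (y ∷ ys) with does (P? y)
... | true  = ∈-++⁺ˡ (∈-map⁺ (y ∷_) (filter∈sublists P? ys))
... | false = ∈-++⁺ʳ (map (y ∷_) (sublists ys)) (filter∈sublists P? ys)

module _ {A : Set} (_≟_ : DecidableEquality A) (xs : List A) (complete : ∀ a → a ∈ₗ xs) where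
  open import Data.List.Membership.DecPropositional _≟_ using () renaming (_∈?_ to _∈ₗ?_)

  indicator : List A → A → Bool
  indicator ys a = does (a ∈ₗ? ys)

  ≗indicator : ∀ (f : A → Bool) → f ≗ indicator (filter (λ a → f a Bool.≟ true) xs)
  ≗indicator f a with f a in fa≡
  ... | true  = sym (dec-true (a ∈ₗ? _) (∈-filter⁺ (λ a → f a Bool.≟ true) (complete a) fa≡))
  ... | false = sym (dec-false (a ∈ₗ? _) λ a∈ →
                  case trans (sym fa≡) (proj₂ (∈-filter⁻ (λ a → f a Bool.≟ true) {xs = xs} a∈)) of λ ())

  anyFunction? : ∀ {P : Pred (A → Bool) 0ℓ} → (∀ {f g} → f ≗ g → P f → P g) → Decidable P → Dec (∃ P)
  anyFunction? resp P? with Any.any? (P? ∘ indicator) (sublists xs)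
  ... | yes found = let ys , Pys = Any.satisfied found in yes (indicator ys , Pys)
  ... | no  ∄ys   = no λ (f , Pf) → ∄ys (lose (filter∈sublists _ xs) (resp (≗indicator f) Pf))

-- Counting edges inside a 4-set

edgesWithin : ThreeGraph n → Subset n → List (Subset n)
edgesWithin {n} H T = filter (λ e → T? (edge H e ∧ ⌊ e ⊆? T ⌋)) (allSubsets n)

module _ (H : ThreeGraph n) (T : Subset n) where

  ∈-edgesWithin⁺ : edge H t ≡ true → t ⊆ T → t ∈ₗ edgesWithin H T
  ∈-edgesWithin⁺ {t} t∈H t⊆T =
    ∈-filter⁺ _ (allSubsets-complete t) (from T-∧ (from T-≡ t∈H , fromWitness (λ {x} → t⊆T {x})))

  ∈-edgesWithin⁻ : t ∈ₗ edgesWithin H T → edge H t ≡ true × t ⊆ T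
  ∈-edgesWithin⁻ t∈ =
    let t∈H , t⊆T = to T-∧ (proj₂ (∈-filter⁻ _ {xs = allSubsets n} t∈))
    in to T-≡ t∈H , toWitness t⊆T

  edgesWithin-unique : Unique (edgesWithin H T)
  edgesWithin-unique = Unique.filter⁺ _ (allSubsets-unique n)

  distinct-edges⇒2≤edgesIn : ∀ {u} → t ≢ u → edge H t ≡ true → edge H u ≡ true → t ⊆ T → u ⊆ T →
                             2 ≤ edgesIn H T
  distinct-edges⇒2≤edgesIn t≢u t∈H u∈H t⊆T u⊆T =
    distinct⇒2≤length _ (∈-edgesWithin⁺ t∈H t⊆T) (∈-edgesWithin⁺ u∈H u⊆T) t≢u

  2≤edgesIn⇒distinct-edges : 2 ≤ edgesIn H T →
    ∃₂ λ t u → t ≢ u × (edge H t ≡ true × t ⊆ T) × (edge H u ≡ true × u ⊆ T)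
  2≤edgesIn⇒distinct-edges 2≤ =
    let t , u , t∈ , u∈ , t≢u = 2≤length⇒distinct _ edgesWithin-unique 2≤
    in t , u , t≢u , ∈-edgesWithin⁻ t∈ , ∈-edgesWithin⁻ u∈

  module _ (∣T∣≡4 : ∣ T ∣ ≡ 4) where

    triple≡T- : t ⊆ T → ∣ t ∣ ≡ 3 → y ∈ T → y ∉ t → t ≡ T - y
    triple≡T- t⊆T ∣t∣≡3 y∈T y∉t =
      ⊆∧∉⇒≡- t⊆T y∈T y∉t (subst₂ _≤_ (sym ∣T∣≡4) (cong suc (sym ∣t∣≡3)) ℕ.≤-refl)

    ∃∉triple : ∣ t ∣ ≡ 3 → ∃ λ y → y ∈ T × y ∉ t
    ∃∉triple ∣t∣≡3 = ∣∣<⇒∃∈∉ (subst₂ _<_ (sym ∣t∣≡3) (sym ∣T∣≡4) ℕ.≤-refl)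

    ∣T-y∣≡3 : y ∈ T → ∣ T - y ∣ ≡ 3
    ∣T-y∣≡3 y∈T = ∣p-x∣≡ y∈T ∣T∣≡4

    clique⇒4≤edgesIn : IsClique H T → 4 ≤ edgesIn H T
    clique⇒4≤edgesIn T-clique =
      subst (_≤ edgesIn H T) ∣T∣≡4
        (∣∣≤length (T -_) T (edgesWithin H T) image (λ u∈T _ → p-x≡p-y⇒x≡y u∈T))
      where
      image : ∀ {y} → y ∈ T → T - y ∈ₗ edgesWithin H T
      image {y} y∈T = ∈-edgesWithin⁺ (T-clique (T - y) (p─q⊆p T _) (∣T-y∣≡3 y∈T)) (p─q⊆p T _)

    -- Each edge inside T misses exactly one vertex of T, and never the one missed by t.
    nonedge⇒edgesIn≤3 : t ⊆ T → ∣ t ∣ ≡ 3 → edge H t ≡ false → edgesIn H T ≤ 3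
    nonedge⇒edgesIn≤3 {t} t⊆T ∣t∣≡3 t∉H with y , y∈T , y∉t ← ∃∉triple ∣t∣≡3 =
      subst (edgesIn H T ≤_) (∣T-y∣≡3 y∈T)
        (length≤∣∣ Missing _ (T - y) edgesWithin-unique image injective)
      where
      Missing : Subset n → Fin n → Set
      Missing u v = v ∈ T × v ∉ u
      ≡T-missing : ∀ {u v} → u ∈ₗ edgesWithin H T → Missing u v → u ≡ T - v
      ≡T-missing u∈ (v∈T , v∉u) =
        let u∈H , u⊆T = ∈-edgesWithin⁻ u∈ in triple≡T- u⊆T (uniform H _ u∈H) v∈T v∉u
      image : ∀ {u} → u ∈ₗ edgesWithin H T → ∃ λ v → v ∈ T - y × Missing u v
      image {u} u∈ =
        let u∈H , _ = ∈-edgesWithin⁻ u∈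
            v , v∈T , v∉u = ∃∉triple (uniform H u u∈H)
            u≢t : u ≢ t
            u≢t u≡t = case trans (sym u∈H) (trans (cong (edge H) u≡t) t∉H) of λ ()
            v≢y : v ≢ y
            v≢y v≡y = u≢t (trans (≡T-missing u∈ (v∈T , v∉u))
                                 (trans (cong (T -_) v≡y) (sym (triple≡T- t⊆T ∣t∣≡3 y∈T y∉t))))
        in v , x∈p∧x≢y⇒x∈p-y v∈T v≢y , v∈T , v∉u
      injective : ∀ {u u′ v} → u ∈ₗ edgesWithin H T → u′ ∈ₗ edgesWithin H T →
                  Missing u v → Missing u′ v → u ≡ u′
      injective u∈ u′∈ m m′ = trans (≡T-missing u∈ m) (sym (≡T-missing u′∈ m′))

K4Closed : ThreeGraph n → Set
K4Closed {n} H = ∀ (T t u : Subset n) → ∣ T ∣ ≡ 4 → t ⊆ T → u ⊆ T → t ≢ u →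
                 edge H t ≡ true → edge H u ≡ true → IsClique H T

≢2∧≢3⇒[2≤⇒4≤] : ∀ {m} → m ≢ 2 → m ≢ 3 → 2 ≤ m → 4 ≤ m
≢2∧≢3⇒[2≤⇒4≤] {1} _ _ (s≤s ())
≢2∧≢3⇒[2≤⇒4≤] {2} m≢2 _ _ = contradiction refl m≢2
≢2∧≢3⇒[2≤⇒4≤] {3} _ m≢3 _ = contradiction refl m≢3
≢2∧≢3⇒[2≤⇒4≤] {suc (suc (suc (suc _)))} _ _ _ = s≤s (s≤s (s≤s (s≤s z≤n)))

[2≤⇒4≤]⇒≢2∧≢3 : ∀ {m} → (2 ≤ m → 4 ≤ m) → m ≢ 2 × m ≢ 3
[2≤⇒4≤]⇒≢2∧≢3 2≤⇒4≤ =
  (λ { refl → case 2≤⇒4≤ (s≤s (s≤s z≤n)) of λ { (s≤s (s≤s ())) } }) ,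
  (λ { refl → case 2≤⇒4≤ (s≤s (s≤s z≤n)) of λ { (s≤s (s≤s (s≤s ()))) } })

Free42-43⇒K4Closed : ∀ {H : ThreeGraph n} → Free42-43 H → K4Closed H
Free42-43⇒K4Closed {H = H} free T t u ∣T∣≡4 t⊆T u⊆T t≢u t∈H u∈H e e⊆T ∣e∣≡3 with edge H e in e∈H
... | true  = refl
... | false = contradiction (≤-trans 4≤edgesIn (nonedge⇒edgesIn≤3 H T ∣T∣≡4 e⊆T ∣e∣≡3 e∈H)) (ℕ.n≮n 3)
  where
  4≤edgesIn = ≢2∧≢3⇒[2≤⇒4≤] (proj₁ (free T ∣T∣≡4)) (proj₂ (free T ∣T∣≡4))
                              (distinct-edges⇒2≤edgesIn H T t≢u t∈H u∈H t⊆T u⊆T)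

K4Closed⇒Free42-43 : ∀ {H : ThreeGraph n} → K4Closed H → Free42-43 H
K4Closed⇒Free42-43 {H = H} closed T ∣T∣≡4 = [2≤⇒4≤]⇒≢2∧≢3 2≤⇒4≤
  where
  2≤⇒4≤ : 2 ≤ edgesIn H T → 4 ≤ edgesIn H T
  2≤⇒4≤ 2≤ with t , u , t≢u , (t∈H , t⊆T) , (u∈H , u⊆T) ← 2≤edgesIn⇒distinct-edges H T 2≤ =
    clique⇒4≤edgesIn H T ∣T∣≡4 (closed T t u ∣T∣≡4 t⊆T u⊆T t≢u t∈H u∈H)

IsClique-⊆ : ∀ {H : ThreeGraph n} {S} → IsClique H S → t ⊆ S → IsClique H t
IsClique-⊆ S-clique t⊆S e e⊆t = S-clique e (t⊆S ∘ e⊆t)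

-- The shadow of a linear hypergraph

Covered : Hypergraph n → Subset n → Set
Covered {n} G t = ∃ λ (e : Subset n) → IsEdge G e × t ⊆ e

ShadowEdge : Hypergraph n → Subset n → Set
ShadowEdge G t = ∣ t ∣ ≡ 3 × Covered G t

shadowEdge? : (G : Hypergraph n) → Decidable (ShadowEdge G)
shadowEdge? G t = (∣ t ∣ ℕ.≟ 3) ×-dec anySubset? λ e → (G e Bool.≟ true) ×-dec (t ⊆? e)

shadow : Hypergraph n → ThreeGraph n
shadow G = record
  { edge    = λ t → does (shadowEdge? G t)
  ; uniform = λ t t∈ → proj₁ (does⇒ (shadowEdge? G t) t∈)
  }

module _ {G : Hypergraph n} where

  shadow-edge⁺ : ∀ {e} → IsEdge G e → t ⊆ e → ∣ t ∣ ≡ 3 → edge (shadow G) t ≡ true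
  shadow-edge⁺ {t} {e} e∈G t⊆e ∣t∣≡3 = dec-true (shadowEdge? G t) (∣t∣≡3 , e , e∈G , t⊆e)

  shadow-edge⁻ : edge (shadow G) t ≡ true → ShadowEdge G t
  shadow-edge⁻ {t} = does⇒ (shadowEdge? G t)

  edge⇒shadow-clique : ∀ {e} → IsEdge G e → IsClique (shadow G) e
  edge⇒shadow-clique e∈G t t⊆e = shadow-edge⁺ e∈G t⊆e

  shadow-coclique⇒TwoIndep : ∀ {I} → IsCoclique (shadow G) I → TwoIndep G I
  shadow-coclique⇒TwoIndep {I} I-coclique e e∈G with ∣ I ∩ e ∣ ≤? 2
  ... | yes ≤2 = ≤2
  ... | no  ≰2 with t , t⊆I∩e , ∣t∣≡3 ← ∃-⊆-∣∣≡ (I ∩ e) 3 (ℕ.≰⇒> ≰2) =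
    case trans (sym (shadow-edge⁺ e∈G (p∩q⊆q I e ∘ t⊆I∩e) ∣t∣≡3)) (I-coclique t (p∩q⊆p I e ∘ t⊆I∩e))
    of λ ()

  TwoIndep⇒shadow-coclique : ∀ {I} → TwoIndep G I → IsCoclique (shadow G) I
  TwoIndep⇒shadow-coclique {I} I-indep t t⊆I = dec-false (shadowEdge? G t) λ (∣t∣≡3 , e , e∈G , t⊆e) →
    ℕ.<⇒≱ (subst (_≤ ∣ I ∩ e ∣) ∣t∣≡3 (p⊆q⇒∣p∣≤∣q∣ λ x∈t → x∈p∩q⁺ (t⊆I x∈t , t⊆e x∈t))) (I-indep e e∈G)

module _ {G : Hypergraph n} (linear : Linear G) where

  common-pair⇒≡ : ∀ {e f} → IsEdge G e → IsEdge G f → p ⊆ e → p ⊆ f → 2 ≤ ∣ p ∣ → e ≡ f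
  common-pair⇒≡ {e = e} {f} e∈G f∈G p⊆e p⊆f 2≤∣p∣ with e ≟ₛ f
  ... | yes e≡f = e≡f
  ... | no  e≢f = contradiction (linear e f e∈G f∈G e≢f)
                    (ℕ.<⇒≱ (≤-trans 2≤∣p∣ (p⊆q⇒∣p∣≤∣q∣ λ x∈p → x∈p∩q⁺ (p⊆e x∈p , p⊆f x∈p))))

  shadow-K4Closed : K4Closed (shadow G)
  shadow-K4Closed T t u ∣T∣≡4 t⊆T u⊆T t≢u t∈H u∈H
    with ∣t∣≡3 , e , e∈G , t⊆e ← shadow-edge⁻ t∈H
       | ∣u∣≡3 , f , f∈G , u⊆f ← shadow-edge⁻ u∈H
    with y , y∈u , y∉t ← ⊈⇒∃∈∉ (λ u⊆t →
           t≢u (sym (⊆∧∣∣≥⇒≡ u⊆t (ℕ.≤-reflexive (trans ∣t∣≡3 (sym ∣u∣≡3))))))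
    = IsClique-⊆ {H = shadow G} (edge⇒shadow-clique e∈G) T⊆e
    where
    T-y⊆e : T - y ⊆ e
    T-y⊆e = t⊆e ∘ subst (_ ∈_) (sym (triple≡T- (shadow G) T ∣T∣≡4 t⊆T ∣t∣≡3 (u⊆T y∈u) y∉t))
    e≡f : e ≡ f
    e≡f = common-pair⇒≡ {p = u - y} e∈G f∈G
            (λ x∈u-y → T-y⊆e (x∈p∧x≢y⇒x∈p-y (u⊆T (x∈p-y⇒x∈p x∈u-y)) (x∈p-y⇒x≢y x∈u-y)))
            (u⊆f ∘ x∈p-y⇒x∈p)
            (ℕ.≤-reflexive (sym (∣p-x∣≡ y∈u ∣u∣≡3)))
    T⊆e : T ⊆ e
    T⊆e {x} x∈T with x Fin.≟ y
    ... | yes refl = subst (x ∈_) (sym e≡f) (u⊆f y∈u)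
    ... | no  x≢y  = T-y⊆e (x∈p∧x≢y⇒x∈p-y x∈T x≢y)

  shadow-clique-covered : ∀ {S} → IsClique (shadow G) S → 3 ≤ ∣ S ∣ → Covered G S
  shadow-clique-covered {S} S-clique 3≤∣S∣
    with t , t⊆S , ∣t∣≡3 ← ∃-⊆-∣∣≡ S 3 3≤∣S∣
    with _ , e , e∈G , t⊆e ← shadow-edge⁻ (S-clique t t⊆S ∣t∣≡3)
    with c , c∈t ← 0<∣p∣⇒∃∈ {p = t} (subst (0 <_) (sym ∣t∣≡3) (s≤s z≤n))
    = e , e∈G , S⊆e
    where
    S⊆e : S ⊆ e
    S⊆e {x} x∈S with x ∈? t
    ... | yes x∈t = t⊆e x∈t
    ... | no  x∉t = x∈e (shadow-edge⁻ (S-clique t′ t′⊆S ∣t′∣≡3))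
      where
      t′ = (t - c) ∪ ⁅ x ⁆
      ∣t′∣≡3 : ∣ t′ ∣ ≡ 3
      ∣t′∣≡3 = trans (∣p∪⁅x⁆∣≡1+∣p∣ (x∉t ∘ x∈p-y⇒x∈p)) (cong suc (∣p-x∣≡ c∈t ∣t∣≡3))
      t′⊆S : t′ ⊆ S
      t′⊆S z∈t′ with x∈p∪q⁻ (t - c) ⁅ x ⁆ z∈t′
      ... | inj₁ z∈t-c = t⊆S (x∈p-y⇒x∈p z∈t-c)
      ... | inj₂ z∈⁅x⁆ = subst (_∈ S) (sym (x∈⁅y⁆⇒x≡y x z∈⁅x⁆)) x∈S
      x∈e : ShadowEdge G t′ → x ∈ e
      x∈e (_ , e′ , e′∈G , t′⊆e′) = subst (x ∈_) (sym e≡e′) (t′⊆e′ (q⊆p∪q (t - c) ⁅ x ⁆ (x∈⁅x⁆ x)))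
        where
        e≡e′ = common-pair⇒≡ {p = t - c} e∈G e′∈G (t⊆e ∘ x∈p-y⇒x∈p) (t′⊆e′ ∘ p⊆p∪q ⁅ x ⁆)
                 (ℕ.≤-reflexive (sym (∣p-x∣≡ c∈t ∣t∣≡3)))

  shadow-IsHomNum : ∀ {m} → IsGNum G m → IsHomNum (shadow G) m
  shadow-IsHomNum {m} (edges≤m , indep≤m , attained) = witness attained , bound
    where
    bound : ∀ S → Homogeneous (shadow G) S → ∣ S ∣ ≤ m
    bound S (inj₂ S-coclique) = indep≤m S (shadow-coclique⇒TwoIndep S-coclique)
    bound S (inj₁ S-clique) with ∣ S ∣ ≤? 2
    ... | yes ∣S∣≤2 = indep≤m S λ e _ → ≤-trans (∣p∩q∣≤∣p∣ S e) ∣S∣≤2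
    ... | no  ∣S∣≰2 with e , e∈G , S⊆e ← shadow-clique-covered S-clique (ℕ.≰⇒> ∣S∣≰2) =
      ≤-trans (p⊆q⇒∣p∣≤∣q∣ S⊆e) (edges≤m e e∈G)
    witness : _ → Σ (Subset n) λ S → Homogeneous (shadow G) S × ∣ S ∣ ≡ m
    witness (inj₁ (e , e∈G , ∣e∣≡m))     = e , inj₁ (edge⇒shadow-clique e∈G) , ∣e∣≡m
    witness (inj₂ (I , I-indep , ∣I∣≡m)) = I , inj₂ (TwoIndep⇒shadow-coclique I-indep) , ∣I∣≡m

-- Maximal cliques of a K4-closed 3-graph

module _ {H : ThreeGraph n} (closed : K4Closed H) where

  glue : ∀ {a b c d} → d ∉ ⟨ a , b , c ⟩ → edge H ⟨ a , b , c ⟩ ≡ true → edge H ⟨ a , b , d ⟩ ≡ true →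
         IsClique H (⟨ a , b , c ⟩ ∪ ⁅ d ⁆)
  glue {a} {b} {c} {d} d∉abc abc∈H abd∈H =
    closed (⟨ a , b , c ⟩ ∪ ⁅ d ⁆) _ _ (trans (∣p∪⁅x⁆∣≡1+∣p∣ d∉abc) (cong suc (uniform H _ abc∈H)))
           (p⊆p∪q ⁅ d ⁆) (⟨⟩⊆ (p⊆p∪q ⁅ d ⁆ ∈⟨⟩₁) (p⊆p∪q ⁅ d ⁆ ∈⟨⟩₂) (q⊆p∪q _ ⁅ d ⁆ (x∈⁅x⁆ d)))
           (λ abc≡abd → d∉abc (subst (d ∈_) (sym abc≡abd) ∈⟨⟩₃)) abc∈H abd∈H

  clique⇒edge⟨⟩ : ∀ {a b c} → IsClique H p → a ∈ p → b ∈ p → c ∈ p → a ≢ b → a ≢ c → b ≢ c →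
                  edge H ⟨ a , b , c ⟩ ≡ true
  clique⇒edge⟨⟩ p-clique a∈p b∈p c∈p a≢b a≢c b≢c = p-clique _ (⟨⟩⊆ a∈p b∈p c∈p) (∣⟨⟩∣≡3 a≢b a≢c b≢c)

  -- {a, b, x, y} is a clique; gluing along the pair {a, x} (z ∈ K) or {a, y} (z ∈ K′)
  -- then brings in z.
  straddling-edge : ∀ {K K′ a b x y z} → IsClique H K → IsClique H K′ →
                    a ∈ K → a ∈ K′ → b ∈ K → b ∈ K′ → a ≢ b → x ∈ K → x ∉ K′ → y ∈ K′ → y ∉ K →
                    z ∈ K ∪ K′ → z ≢ x → z ≢ y → edge H ⟨ x , y , z ⟩ ≡ true
  straddling-edge {K} {K′} {a} {b} {x} {y} {z}
                  K-clique K′-clique a∈K a∈K′ b∈K b∈K′ a≢b x∈K x∉K′ y∈K′ y∉K z∈K∪K′ z≢x z≢y =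
    by-cases (z Fin.≟ a) (x∈p∪q⁻ K K′ z∈K∪K′)
    where
    ∈ˡ : ∀ {p w d} → w ∈ p → w ∈ p ∪ ⁅ d ⁆
    ∈ˡ {d = d} = p⊆p∪q ⁅ d ⁆
    ∈ʳ : ∀ {p d} → d ∈ p ∪ ⁅ d ⁆
    ∈ʳ {p} {d} = q⊆p∪q p ⁅ d ⁆ (x∈⁅x⁆ d)
    a≢x = ∈∧∉⇒≢ a∈K′ x∉K′
    b≢x = ∈∧∉⇒≢ b∈K′ x∉K′
    a≢y = ∈∧∉⇒≢ a∈K y∉K
    b≢y = ∈∧∉⇒≢ b∈K y∉K
    x≢y = ∈∧∉⇒≢ x∈K y∉K
    x≢z = z≢x ∘ sym
    y≢z = z≢y ∘ sym
    abxy-clique : IsClique H (⟨ a , b , x ⟩ ∪ ⁅ y ⁆)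
    abxy-clique = glue (y∉K ∘ ⟨⟩⊆ a∈K b∈K x∈K) (clique⇒edge⟨⟩ K-clique a∈K b∈K x∈K a≢b a≢x b≢x)
                                                (clique⇒edge⟨⟩ K′-clique a∈K′ b∈K′ y∈K′ a≢b a≢y b≢y)
    by-cases : Dec (z ≡ a) → z ∈ K ⊎ z ∈ K′ → edge H ⟨ x , y , z ⟩ ≡ true
    by-cases (yes z≡a) _ =
      clique⇒edge⟨⟩ abxy-clique (∈ˡ ∈⟨⟩₃) ∈ʳ (subst (_∈ _) (sym z≡a) (∈ˡ ∈⟨⟩₁)) x≢y x≢z y≢z
    by-cases (no z≢a) (inj₁ z∈K) =
      clique⇒edge⟨⟩ (glue (y∉K ∘ ⟨⟩⊆ a∈K x∈K z∈K) axz∈H axy∈H) (∈ˡ ∈⟨⟩₂) ∈ʳ (∈ˡ ∈⟨⟩₃) x≢y x≢z y≢z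
      where
      axz∈H = clique⇒edge⟨⟩ K-clique a∈K x∈K z∈K a≢x (z≢a ∘ sym) x≢z
      axy∈H = clique⇒edge⟨⟩ abxy-clique (∈ˡ ∈⟨⟩₁) (∈ˡ ∈⟨⟩₃) ∈ʳ a≢x a≢y x≢y
    by-cases (no z≢a) (inj₂ z∈K′) =
      clique⇒edge⟨⟩ (glue (x∉K′ ∘ ⟨⟩⊆ a∈K′ y∈K′ z∈K′) ayz∈H ayx∈H) ∈ʳ (∈ˡ ∈⟨⟩₂) (∈ˡ ∈⟨⟩₃) x≢y x≢z y≢z
      where
      ayz∈H = clique⇒edge⟨⟩ K′-clique a∈K′ y∈K′ z∈K′ a≢y (z≢a ∘ sym) y≢z
      ayx∈H = clique⇒edge⟨⟩ abxy-clique (∈ˡ ∈⟨⟩₁) ∈ʳ (∈ˡ ∈⟨⟩₃) a≢y a≢x (x≢y ∘ sym)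

  merge : ∀ {K K′} → IsClique H K → IsClique H K′ → 2 ≤ ∣ K ∩ K′ ∣ → IsClique H (K ∪ K′)
  merge {K} {K′} K-clique K′-clique 2≤∣K∩K′∣ t t⊆K∪K′ ∣t∣≡3 with t ⊆? K | t ⊆? K′
  ... | yes t⊆K | _        = K-clique t t⊆K ∣t∣≡3
  ... | no  _   | yes t⊆K′ = K′-clique t t⊆K′ ∣t∣≡3
  ... | no  t⊈K | no  t⊈K′
    with x , x∈t , x∉K′ ← ⊈⇒∃∈∉ t⊈K′
       | y , y∈t , y∉K ← ⊈⇒∃∈∉ t⊈K
       | a , b , a∈K∩K′ , b∈K∩K′ , a≢b ← 2≤∣p∣⇒∃-distinct 2≤∣K∩K′∣
    with x∈K ← x∈p∪q∧x∉q⇒x∈p (t⊆K∪K′ x∈t) x∉K′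
       | y∈K′ ← x∈p∪q∧x∉p⇒x∈q (t⊆K∪K′ y∈t) y∉K
    with y∈t-x ← x∈p∧x≢y⇒x∈p-y y∈t (∈∧∉⇒≢ x∈K y∉K ∘ sym)
    with z , z∈t-x-y ← 0<∣p∣⇒∃∈ {p = t - x - y}
                         (subst (0 <_) (sym (∣p-x∣≡ y∈t-x (∣p-x∣≡ x∈t ∣t∣≡3))) (s≤s z≤n))
    = subst (λ s → edge H s ≡ true) xyz≡t
        (straddling-edge K-clique K′-clique (proj₁ a∈) (proj₂ a∈) (proj₁ b∈) (proj₂ b∈) a≢b
                         x∈K x∉K′ y∈K′ y∉K (t⊆K∪K′ z∈t) z≢x z≢y)
    where
    a∈ = x∈p∩q⁻ K K′ a∈K∩K′
    b∈ = x∈p∩q⁻ K K′ b∈K∩K′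
    z∈t = x∈p-y⇒x∈p (x∈p-y⇒x∈p z∈t-x-y)
    z≢x = x∈p-y⇒x≢y (x∈p-y⇒x∈p z∈t-x-y)
    z≢y = x∈p-y⇒x≢y z∈t-x-y
    xyz≡t : ⟨ x , y , z ⟩ ≡ t
    xyz≡t = ⊆∧∣∣≥⇒≡ (⟨⟩⊆ x∈t y∈t z∈t)
              (ℕ.≤-reflexive (trans ∣t∣≡3 (sym (∣⟨⟩∣≡3 (∈∧∉⇒≢ x∈K y∉K) (z≢x ∘ sym) (z≢y ∘ sym)))))

GBound : Hypergraph n → ℕ → Set
GBound {n} G k =
  (∀ (e : Subset n) → IsEdge G e → ∣ e ∣ ≤ k) × (∀ (I : Subset n) → TwoIndep G I → ∣ I ∣ ≤ k)

module _ (H : ThreeGraph n) where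

  clique? : Decidable (IsClique H)
  clique? p = allSubset? λ e → (e ⊆? p) →-dec ((∣ e ∣ ℕ.≟ 3) →-dec (edge H e Bool.≟ true))

  bigMaximalClique? : Decidable (λ K → Maximal clique? K × 3 ≤ ∣ K ∣)
  bigMaximalClique? K = maximal? clique? K ×-dec (3 ≤? ∣ K ∣)

  maximalCliques : Hypergraph n
  maximalCliques K = does (bigMaximalClique? K)

  edge⇒clique : edge H t ≡ true → IsClique H t
  edge⇒clique {t} t∈H e e⊆t ∣e∣≡3 =
    subst (λ s → edge H s ≡ true)
      (sym (⊆∧∣∣≥⇒≡ e⊆t (ℕ.≤-reflexive (trans (uniform H t t∈H) (sym ∣e∣≡3))))) t∈H

  edge-covered : edge H t ≡ true → Covered maximalCliques t
  edge-covered {t} t∈H with K , t⊆K , K-maximal ← ⊆-maximal clique? (edge⇒clique t∈H) =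
    K , dec-true (bigMaximalClique? K) (K-maximal , 3≤∣K∣) , t⊆K
    where
    3≤∣K∣ : 3 ≤ ∣ K ∣
    3≤∣K∣ = subst (_≤ ∣ K ∣) (uniform H t t∈H) (p⊆q⇒∣p∣≤∣q∣ t⊆K)

  maximalCliques-linear : K4Closed H → Linear maximalCliques
  maximalCliques-linear closed K K′ K∈ K′∈ K≢K′ with ∣ K ∩ K′ ∣ ≤? 1
  ... | yes ≤1 = ≤1
  ... | no  ≰1
    with (K-clique , K-max) , _ ← does⇒ (bigMaximalClique? K) K∈
       | (K′-clique , K′-max) , _ ← does⇒ (bigMaximalClique? K′) K′∈
    = contradiction (⊆-antisym K⊆K′ K′⊆K) K≢K′
    where
    K∪K′-clique = merge {H = H} closed K-clique K′-clique (ℕ.≰⇒> ≰1)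
    K′⊆K : K′ ⊆ K
    K′⊆K = K-max (K ∪ K′) (p⊆p∪q K′) K∪K′-clique ∘ q⊆p∪q K K′
    K⊆K′ : K ⊆ K′
    K⊆K′ = K′-max (K ∪ K′) (q⊆p∪q K K′) K∪K′-clique ∘ p⊆p∪q K′

  maximalCliques-GBound : ∀ {k} → IsHomNum H k → GBound maximalCliques k
  maximalCliques-GBound (_ , hom≤k) =
    (λ K K∈ → hom≤k K (inj₁ (proj₁ (proj₁ (does⇒ (bigMaximalClique? K) K∈))))) ,
    (λ I I-indep → hom≤k I (inj₂ (TwoIndep⇒coclique I-indep)))
    where
    TwoIndep⇒coclique : ∀ {I} → TwoIndep maximalCliques I → IsCoclique H I
    TwoIndep⇒coclique {I} I-indep t t⊆I with edge H t in t∈H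
    ... | false = refl
    ... | true with K , K∈ , t⊆K ← edge-covered t∈H =
      contradiction (I-indep K K∈)
        (ℕ.<⇒≱ (subst (_≤ ∣ I ∩ K ∣) (uniform H t t∈H) (p⊆q⇒∣p∣≤∣q∣ λ x∈t → x∈p∩q⁺ (t⊆I x∈t , t⊆K x∈t))))

-- The least g-value of a linear hypergraph

module _ (G : Hypergraph n) where

  twoIndep? : Decidable (TwoIndep G)
  twoIndep? I = allSubset? λ e → (G e Bool.≟ true) →-dec (∣ I ∩ e ∣ ≤? 2)

  gBound? : Decidable (GBound G)
  gBound? k = allSubset? (λ e → (G e Bool.≟ true) →-dec (∣ e ∣ ≤? k)) ×-dec
              allSubset? (λ I → twoIndep? I →-dec (∣ I ∣ ≤? k))

  linear? : Dec (Linear G)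
  linear? = allSubset? λ e → allSubset? λ f →
    (G e Bool.≟ true) →-dec ((G f Bool.≟ true) →-dec (¬? (e ≟ₛ f) →-dec (∣ e ∩ f ∣ ≤? 1)))

  least-GBound⇒IsGNum : ∀ {m} → GBound G m → (∀ j → GBound G j → m ≤ j) → IsGNum G m
  least-GBound⇒IsGNum {zero} (edges≤0 , indep≤0) _ =
    edges≤0 , indep≤0 , inj₂ (⊥ , ⊥-indep , ∣⊥∣≡0 n)
    where
    ⊥-indep : TwoIndep G ⊥
    ⊥-indep e _ = ≤-trans (∣p∩q∣≤∣p∣ ⊥ e) (subst (_≤ 2) (sym (∣⊥∣≡0 n)) z≤n)
  least-GBound⇒IsGNum {suc j} (edges≤ , indep≤) minimal = edges≤ , indep≤ , attained
    where
    attained : (∃ λ e → IsEdge G e × ∣ e ∣ ≡ suc j) ⊎ (∃ λ I → TwoIndep G I × ∣ I ∣ ≡ suc j)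
    attained with anySubset? (λ e → (G e Bool.≟ true) ×-dec ¬? (∣ e ∣ ≤? j))
    ... | yes (e , e∈G , ∣e∣≰j) = inj₁ (e , e∈G , ℕ.≤-antisym (edges≤ e e∈G) (ℕ.≰⇒> ∣e∣≰j))
    ... | no  ∄e with anySubset? (λ I → twoIndep? I ×-dec ¬? (∣ I ∣ ≤? j))
    ...   | yes (I , I-indep , ∣I∣≰j) = inj₂ (I , I-indep , ℕ.≤-antisym (indep≤ I I-indep) (ℕ.≰⇒> ∣I∣≰j))
    ...   | no  ∄I = contradiction (minimal j bound-j) ℕ.1+n≰n
      where
      bound-j : GBound G j
      bound-j = (λ e e∈G → decidable-stable (∣ e ∣ ≤? j) λ ∣e∣≰j → ∄e (e , e∈G , ∣e∣≰j)) ,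
                (λ I I-indep → decidable-stable (∣ I ∣ ≤? j) λ ∣I∣≰j → ∄I (I , I-indep , ∣I∣≰j))

module _ {G G′ : Hypergraph n} (G≗G′ : G ≗ G′) where

  Linear-resp : Linear G → Linear G′
  Linear-resp G-linear e f e∈G′ f∈G′ = G-linear e f (trans (G≗G′ e) e∈G′) (trans (G≗G′ f) f∈G′)

  GBound-resp : ∀ {k} → GBound G k → GBound G′ k
  GBound-resp (edges≤ , indep≤) =
    (λ e e∈G′ → edges≤ e (trans (G≗G′ e) e∈G′)) ,
    (λ I I-indep → indep≤ I λ e e∈G → I-indep e (trans (sym (G≗G′ e)) e∈G))

LinearGBound : ℕ → ℕ → Set
LinearGBound n k = ∃ λ (G : Hypergraph n) → Linear G × GBound G k

linearGBound? : ∀ n → Decidable (LinearGBound n)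
linearGBound? n k =
  anyFunction? _≟ₛ_ (allSubsets n) allSubsets-complete
    (λ G≗G′ (G-linear , G-bound) → Linear-resp G≗G′ G-linear , GBound-resp G≗G′ G-bound)
    (λ G → linear? G ×-dec gBound? G k)

empty-LinearGBound : LinearGBound n n
empty-LinearGBound = (λ _ → false) , (λ _ _ ()) , (λ e _ → ∣p∣≤n e) , (λ I _ → ∣p∣≤n I)

lemma5p3 : ∀ (n : ℕ) → 1 ≤ n → Σ ℕ λ m → IsH3 n m × IsG n m
lemma5p3 n _ with m , (G , G-linear , G-bound) , m-least ← least (linearGBound? n) empty-LinearGBound =
  m , ((shadow G , shadow-free , shadow-IsHomNum G-linear G-gNum) , h₃-lower) ,
      ((G , G-linear , G-gNum) , g-lower)
  where
  G-gNum : IsGNum G m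
  G-gNum = least-GBound⇒IsGNum G G-bound λ j G-j → m-least j (G , G-linear , G-j)
  shadow-free : Free42-43 (shadow G)
  shadow-free = K4Closed⇒Free42-43 {H = shadow G} (shadow-K4Closed G-linear)
  h₃-lower : ∀ H → Free42-43 H → ∀ k → IsHomNum H k → m ≤ k
  h₃-lower H H-free k H-hom =
    m-least k ( maximalCliques H
              , maximalCliques-linear H (Free42-43⇒K4Closed {H = H} H-free)
              , maximalCliques-GBound H H-hom )
  g-lower : ∀ G′ → Linear G′ → ∀ k → IsGNum G′ k → m ≤ k
  g-lower G′ G′-linear k (edges≤k , indep≤k , _) = m-least k (G′ , G′-linear , edges≤k , indep≤k)
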